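{- For all integers $v\ge4$ and $d\ge1$, $\left|\mathcal{D}_{v,d}(132,213, 321)\right| = d$.
   Context: A diamond with $v$ vertices ($v\ge4$) is the poset with a least element, a greatest element, and $v-2$ pairwise incomparable middle elements (in a fixed left-to-right order) strictly between them. $\mathcal{D}_{v,d}$ is the set of labellings of $d$ diamonds (placed left to right) by $1,\dots,vd$, each label used once, such that in each diamond least label $<$ each middle label $<$ greatest label. For $D\in\mathcal{D}_{v,d}$, $\pi_D$ is the permutation obtained by reading the diamonds left to right and, within each diamond, the least element, then the middle elements left to right, then the greatest element. $\mathcal{D}_{v,d}(P)$ is the set of $D$ with $\pi_D$ avoiding every classical pattern in $P$. -}

module Defs where

open import Data.Nat using (ℕ; suc; _<_; _∸_; _*_)
open import Data.Fin using (Fin)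
open import Data.Product using (Σ; _×_; _,_)
open import Data.List using (List; []; _∷_; _++_; [_]; length; lookup; map; upTo; concatMap)
open import Data.List.Relation.Unary.All using (All)
open import Data.List.Relation.Binary.Permutation.Propositional using (_↭_)
open import Data.Vec using (Vec)
import Data.Vec as V
import Data.Vec.Relation.Unary.All as VAll
open import Relation.Nullary using (¬_)
open import Function.Bundles using (_⇔_)

-- A labelled diamond with v vertices: (least label, middle labels left to right, greatest label).
Diamond : ℕ → Set
Diamond v = ℕ × Vec ℕ (v ∸ 2) × ℕ

readDiamond : (v : ℕ) → Diamond v → List ℕ
readDiamond v (l , m , g) = l ∷ (V.toList m ++ [ g ])

DiamondOrdered : (v : ℕ) → Diamond v → Set
DiamondOrdered v (l , m , g) = All (λ x → (l < x) × (x < g)) (V.toList m)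

Labelling : ℕ → ℕ → Set
Labelling v d = Vec (Diamond v) d

πD : (v d : ℕ) → Labelling v d → List ℕ
πD v d D = concatMap (readDiamond v) (V.toList D)

oneTo : ℕ → List ℕ
oneTo n = map suc (upTo n)

InD : (v d : ℕ) → Labelling v d → Set
InD v d D = (πD v d D ↭ oneTo (v * d)) × VAll.All (DiamondOrdered v) D


Contains : List ℕ → List ℕ → Set
Contains σ π =
  Σ (Fin (length σ) → Fin (length π)) λ f →
    (∀ i j → i Data.Fin.< j → f i Data.Fin.< f j) ×
    (∀ i j → (lookup π (f i) < lookup π (f j)) ⇔ (lookup σ i < lookup σ j))

Avoids : List (List ℕ) → List ℕ → Set
Avoids P π = All (λ σ → ¬ Contains σ π) P

InDP : (v d : ℕ) → List (List ℕ) → Labelling v d → Set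
InDP v d P D = InD v d D × Avoids P (πD v d D)

p132 p213 p321 : List ℕ
p132 = 1 ∷ 3 ∷ 2 ∷ []
p213 = 2 ∷ 1 ∷ 3 ∷ []
p321 = 3 ∷ 2 ∷ 1 ∷ []

-- A permutation of 1, …, n avoiding 132, 213 and 321 is a rotation q+1, …, n, 1, …, q.
-- Indeed, let a, b be adjacent entries.  If a < b, a value strictly between them, and if
-- b < a, a value below b or above a, would complete one of the three patterns together
-- with the pair, on whichever side of the pair it stands; so every entry is the cyclic
-- successor of the previous one.  Conversely a rotation is an increasing run followed by
-- an increasing run lying below it; its inversions are exactly the pairs straddling the
-- two runs, which is incompatible with an occurrence of 132, 213 or 321.  Cutting the
-- rotation starting at q+1 into d blocks of v consecutive entries, a block is a
-- well-labelled diamond exactly when the step n → 1 does not occur inside it, that is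
-- when v divides q; this leaves the d labellings with q = 0, v, …, (d-1)v.

module Submission where

open import Defs
open import Data.Empty using (⊥; ⊥-elim)
open import Data.Fin as Fin using (Fin; toℕ; #_)
import Data.Fin.Properties as Fin
open import Data.List as List using (List; []; _∷_; _++_; _∷ʳ_; [_]; length; lookup; map; upTo; applyUpTo)
open import Data.List.Properties using (∷-injective; ++-assoc; map-upTo; length-iterate; length-map; length-upTo)
open import Data.List.Membership.Propositional using (_∈_)
open import Data.List.Membership.Propositional.Properties using (∈-lookup; ∈-map⁺; ∈-map⁻; ∈-upTo⁺; ∈-upTo⁻)
open import Data.List.Relation.Unary.All as All using (All; []; _∷_)
import Data.List.Relation.Unary.All.Properties as All⁺
open import Data.List.Relation.Unary.Any using (index; here)
open import Data.List.Relation.Unary.Any.Properties using (lookup-index)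
open import Data.List.Relation.Unary.Linked using (Linked; []; [-]; _∷_)
open import Data.List.Relation.Unary.Unique.Propositional using (Unique; _∷_)
import Data.List.Relation.Unary.Unique.Propositional.Properties as Unique
open import Data.List.Relation.Binary.Permutation.Propositional using (_↭_; ↭-sym; ↭⇒↭ₛ; module PermutationReasoning)
open import Data.List.Relation.Binary.Permutation.Propositional.Properties using (++-comm; ∈-resp-↭; ↭-length)
open import Data.Nat using (ℕ; zero; suc; _+_; _*_; _∸_; _≤_; _<_; _≮_; _<?_; z≤n; s≤s; z<s; s<s)
open import Data.Nat.Properties
open import Data.Nat.Divisibility using (_∣_; divides; ∣m+n∣m⇒∣n; ∣m∣n⇒∣m+n; ∣-refl; _∣0; m∣m*n)
import Data.Nat.GeneralisedArithmetic as ℕ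
open import Data.Product using (Σ; ∃; _×_; _,_; proj₁; proj₂)
open import Data.Sum using (_⊎_; inj₁; inj₂)
open import Data.Vec as Vec using (Vec)
import Data.Vec.Relation.Unary.All as VAll
open import Function using (_∘_)
open import Function.Bundles using (_⇔_; mk⇔; Equivalence)
open import Relation.Binary using (tri<; tri≈; tri>)
open import Relation.Binary.PropositionalEquality hiding ([_])
open import Data.List.Relation.Binary.Permutation.Setoid.Properties (setoid ℕ) using (Unique-resp-↭)
open import Relation.Nullary using (¬_; yes; no; contradiction)

private
  variable
    A : Set

iterate-suc : ∀ (f : A → A) x k → ℕ.iterate f x (suc k) ≡ f (ℕ.iterate f x k)
iterate-suc f x zero    = refl
iterate-suc f x (suc k) = iterate-suc f (f x) k

iterate-+ : ∀ (f : A → A) x a b → ℕ.iterate f x (a + b) ≡ ℕ.iterate f (ℕ.iterate f x a) b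
iterate-+ f x zero    b = refl
iterate-+ f x (suc a) b = iterate-+ f (f x) a b

iterate-++ : ∀ (f : A → A) x a b →
             List.iterate f x (a + b) ≡ List.iterate f x a ++ List.iterate f (ℕ.iterate f x a) b
iterate-++ f x zero    b = refl
iterate-++ f x (suc a) b = cong (x ∷_) (iterate-++ f (f x) a b)

iterate-∷ʳ : ∀ (f : A → A) x k → List.iterate f x (suc k) ≡ List.iterate f x k ∷ʳ ℕ.iterate f x k
iterate-∷ʳ f x zero    = refl
iterate-∷ʳ f x (suc k) = cong (x ∷_) (iterate-∷ʳ f (f x) k)

lookup-iterate : ∀ (f : A → A) x k (i : Fin (length (List.iterate f x k))) →
                 lookup (List.iterate f x k) i ≡ ℕ.iterate f x (toℕ i)
lookup-iterate f x (suc k) Fin.zero    = refl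
lookup-iterate f x (suc k) (Fin.suc i) = lookup-iterate f (f x) k i

toList-iterate : ∀ (f : A → A) x k → Vec.toList (Vec.iterate f x k) ≡ List.iterate f x k
toList-iterate f x zero    = refl
toList-iterate f x (suc k) = cong (x ∷_) (toList-iterate f (f x) k)

Linked⇒iterate : ∀ {f : A → A} {x} xs → Linked (λ a b → b ≡ f a) (x ∷ xs) →
                 x ∷ xs ≡ List.iterate f x (suc (length xs))
Linked⇒iterate []       _               = refl
Linked⇒iterate {x = x} (y ∷ xs) (refl ∷ linked) = cong (x ∷_) (Linked⇒iterate xs linked)

adjacent⇒Linked : ∀ {R : A → A → Set} (xs : List A) →
  (∀ (i j : Fin (length xs)) → toℕ j ≡ suc (toℕ i) → R (lookup xs i) (lookup xs j)) → Linked R xs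
adjacent⇒Linked []           _   = []
adjacent⇒Linked (x ∷ [])     _   = [-]
adjacent⇒Linked (x ∷ y ∷ xs) adj =
  adj Fin.zero (Fin.suc Fin.zero) refl
  ∷ adjacent⇒Linked (y ∷ xs) (λ i j e → adj (Fin.suc i) (Fin.suc j) (cong suc e))

toList-++-injective : ∀ {m} (u w : Vec A m) {ys zs} → Vec.toList u ++ ys ≡ Vec.toList w ++ zs → u ≡ w × ys ≡ zs
toList-++-injective Vec.[]       Vec.[]       eq = refl , eq
toList-++-injective (x Vec.∷ u) (y Vec.∷ w) eq
  with refl , eq′ ← ∷-injective eq
  with refl , refl ← toList-++-injective u w eq′ = refl , refl

Unique-lookup-injective : ∀ {xs : List A} → Unique xs → ∀ {i j} → lookup xs i ≡ lookup xs j → i ≡ j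
Unique-lookup-injective (x∉ ∷ u) {Fin.zero}  {Fin.zero}  _  = refl
Unique-lookup-injective (x∉ ∷ u) {Fin.zero}  {Fin.suc j} eq = contradiction eq (All.lookup x∉ (∈-lookup j))
Unique-lookup-injective (x∉ ∷ u) {Fin.suc i} {Fin.zero}  eq = contradiction (sym eq) (All.lookup x∉ (∈-lookup i))
Unique-lookup-injective (x∉ ∷ u) {Fin.suc i} {Fin.suc j} eq = cong Fin.suc (Unique-lookup-injective u eq)

range : ℕ → ℕ → List ℕ
range = List.iterate suc

iterate-suc-+ : ∀ a b → ℕ.iterate suc a b ≡ a + b
iterate-suc-+ a zero    = sym (+-identityʳ a)
iterate-suc-+ a (suc b) = trans (iterate-suc-+ (suc a) b) (sym (+-suc a b))

range-++ : ∀ a b c → range a (b + c) ≡ range a b ++ range (a + b) c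
range-++ a b c = trans (iterate-++ suc a b c) (cong (λ s → range a b ++ range s c) (iterate-suc-+ a b))

applyUpTo-iterate : ∀ {f : A → A} {h : ℕ → A} x k → (∀ i → h i ≡ ℕ.iterate f x i) →
                    applyUpTo h k ≡ List.iterate f x k
applyUpTo-iterate x zero    h≗ = refl
applyUpTo-iterate x (suc k) h≗ = cong₂ _∷_ (h≗ 0) (applyUpTo-iterate _ k (h≗ ∘ suc))

oneTo≡range : ∀ n → oneTo n ≡ range 1 n
oneTo≡range n = trans (map-upTo suc n) (applyUpTo-iterate 1 n (λ i → sym (iterate-suc-+ 1 i)))

∈-oneTo⇔ : ∀ {w n} → w ∈ oneTo n ⇔ (1 ≤ w × w ≤ n)
∈-oneTo⇔ {w} {n} = mk⇔ bounded occurs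
  where
  bounded : w ∈ oneTo n → 1 ≤ w × w ≤ n
  bounded w∈ with i , i∈ , refl ← ∈-map⁻ suc w∈ = s≤s z≤n , ∈-upTo⁻ i∈
  occurs : 1 ≤ w × w ≤ n → w ∈ oneTo n
  occurs (s≤s z≤n , w≤n) = ∈-map⁺ suc (∈-upTo⁺ w≤n)

oneTo-Unique : ∀ n → Unique (oneTo n)
oneTo-Unique n = Unique.map⁺ suc-injective (Unique.upTo⁺ n)

length-oneTo : ∀ n → length (oneTo n) ≡ n
length-oneTo n = trans (length-map suc (upTo n)) (length-upTo n)

module _ {xs : List ℕ} {n : ℕ} (xs↭ : xs ↭ oneTo n) where

  ↭oneTo⇒∈⇔ : ∀ {w} → w ∈ xs ⇔ (1 ≤ w × w ≤ n)
  ↭oneTo⇒∈⇔ = mk⇔ (Equivalence.to ∈-oneTo⇔ ∘ ∈-resp-↭ xs↭)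
                  (∈-resp-↭ (↭-sym xs↭) ∘ Equivalence.from ∈-oneTo⇔)

  ↭oneTo⇒Unique : Unique xs
  ↭oneTo⇒Unique = Unique-resp-↭ (↭⇒↭ₛ (↭-sym xs↭)) (oneTo-Unique n)

  ↭oneTo⇒length : length xs ≡ n
  ↭oneTo⇒length = trans (↭-length xs↭) (length-oneTo n)

All-range : ∀ a k → All (λ z → a ≤ z × z < a + k) (range a k)
All-range a zero    = []
All-range a (suc k) = (≤-refl , m<m+n a (s≤s z≤n))
                    ∷ All.map (λ (a<z , z<) → <⇒≤ a<z , <-≤-trans z< (≤-reflexive (sym (+-suc a k))))
                              (All-range (suc a) k)

πD-∷ : ∀ v k l (u : Vec ℕ (v ∸ 2)) g (D : Labelling v k) →
       πD v (suc k) ((l , u , g) Vec.∷ D) ≡ l ∷ Vec.toList u ++ g ∷ πD v k D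
πD-∷ v k l u g D = cong (l ∷_) (++-assoc (Vec.toList u) [ g ] (πD v k D))

πD-injective : ∀ v k (D D′ : Labelling v k) → πD v k D ≡ πD v k D′ → D ≡ D′
πD-injective v zero    Vec.[] Vec.[] _ = refl
πD-injective v (suc k) ((l , u , g) Vec.∷ D) ((l′ , u′ , g′) Vec.∷ D′) eq
  with refl , eq′ ← ∷-injective (trans (sym (πD-∷ v k l u g D)) (trans eq (πD-∷ v k l′ u′ g′ D′)))
  with refl , eq″ ← toList-++-injective u u′ eq′
  with refl , eq‴ ← ∷-injective eq″
  with refl ← πD-injective v k D D′ eq‴ = refl

-- Patterns of length three

forbidden : List (List ℕ)
forbidden = p132 ∷ p213 ∷ p321 ∷ []

-- rank₃ x y z sends the letters 1, 2, 3 of a pattern to the values x < y < z of an occurrence.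
rank₃ : ℕ → ℕ → ℕ → ℕ → ℕ
rank₃ x y z 1 = x
rank₃ x y z 2 = y
rank₃ x y z _ = z

Digit₃ : ℕ → Set
Digit₃ k = 1 ≤ k × k ≤ 3

module _ {x y z : ℕ} (x<y : x < y) (y<z : y < z) where

  rank₃-< : ∀ {k l} → Digit₃ k → Digit₃ l → k < l → rank₃ x y z k < rank₃ x y z l
  rank₃-< {1} {2} _ _ _ = x<y
  rank₃-< {1} {3} _ _ _ = <-trans x<y y<z
  rank₃-< {2} {3} _ _ _ = y<z
  rank₃-< {1} {1} _ _ (s≤s ())
  rank₃-< {2} {1} _ _ (s≤s ())
  rank₃-< {2} {2} _ _ (s≤s (s≤s ()))
  rank₃-< {3} {3} _ _ (s≤s (s≤s (s≤s ())))
  rank₃-< {_} {suc (suc (suc (suc _)))} _ (_ , s≤s (s≤s (s≤s ()))) _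
  rank₃-< {suc (suc (suc (suc _)))} _ (_ , l≤3) k<l with ≤-trans k<l l≤3
  ... | s≤s (s≤s (s≤s ()))
  rank₃-< {0} {_} (() , _) _ _
  rank₃-< {_} {0} _ _ ()

  rank₃-<⇔ : ∀ {k l} → Digit₃ k → Digit₃ l → rank₃ x y z k < rank₃ x y z l ⇔ k < l
  rank₃-<⇔ {k} {l} dk dl = mk⇔ reflect (rank₃-< dk dl)
    where
    reflect : rank₃ x y z k < rank₃ x y z l → k < l
    reflect r with <-cmp k l
    ... | tri< k<l _ _ = k<l
    ... | tri≈ _ refl _ = contradiction r (<-irrefl refl)
    ... | tri> _ _ l<k = contradiction r (<-asym (rank₃-< dl dk l<k))

  contains₃ : ∀ {a b c} π {p q r : Fin (length π)} → All Digit₃ (a ∷ b ∷ c ∷ []) →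
              p Fin.< q → q Fin.< r →
              lookup π p ≡ rank₃ x y z a → lookup π q ≡ rank₃ x y z b → lookup π r ≡ rank₃ x y z c →
              Contains (a ∷ b ∷ c ∷ []) π
  contains₃ {a} {b} {c} π {p} {q} {r} digits p<q q<r πp πq πr =
    position , increasing ,
    λ i j → subst₂ (λ s t → s < t ⇔ _) (sym (value i)) (sym (value j))
                   (rank₃-<⇔ (All.lookup digits (∈-lookup i)) (All.lookup digits (∈-lookup j)))
    where
    σ = a ∷ b ∷ c ∷ []
    position : Fin 3 → Fin (length π)
    position = Vec.lookup (p Vec.∷ q Vec.∷ r Vec.∷ Vec.[])
    increasing : ∀ i j → i Fin.< j → position i Fin.< position j
    increasing Fin.zero (Fin.suc Fin.zero) _ = p<q
    increasing Fin.zero (Fin.suc (Fin.suc Fin.zero)) _ = <-trans p<q q<r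
    increasing (Fin.suc Fin.zero) (Fin.suc (Fin.suc Fin.zero)) _ = q<r
    increasing Fin.zero Fin.zero ()
    increasing (Fin.suc Fin.zero) Fin.zero ()
    increasing (Fin.suc Fin.zero) (Fin.suc Fin.zero) (s≤s ())
    increasing (Fin.suc (Fin.suc Fin.zero)) Fin.zero ()
    increasing (Fin.suc (Fin.suc Fin.zero)) (Fin.suc Fin.zero) (s≤s ())
    increasing (Fin.suc (Fin.suc Fin.zero)) (Fin.suc (Fin.suc Fin.zero)) (s≤s (s≤s ()))
    value : ∀ i → lookup π (position i) ≡ rank₃ x y z (lookup σ i)
    value Fin.zero = πp
    value (Fin.suc Fin.zero) = πq
    value (Fin.suc (Fin.suc Fin.zero)) = πr

digit₁ : Digit₃ 1
digit₁ = s≤s z≤n , s≤s z≤n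

digit₂ : Digit₃ 2
digit₂ = s≤s z≤n , s≤s (s≤s z≤n)

digit₃ : Digit₃ 3
digit₃ = s≤s z≤n , ≤-refl

module _ (π : List ℕ) {p q r : Fin (length π)} (p<q : p Fin.< q) (q<r : q Fin.< r) where

  contains132 : lookup π p < lookup π r → lookup π r < lookup π q → Contains p132 π
  contains132 x<y y<z = contains₃ x<y y<z π (digit₁ ∷ digit₃ ∷ digit₂ ∷ []) p<q q<r refl refl refl

  contains213 : lookup π q < lookup π p → lookup π p < lookup π r → Contains p213 π
  contains213 x<y y<z = contains₃ x<y y<z π (digit₂ ∷ digit₁ ∷ digit₃ ∷ []) p<q q<r refl refl refl

  contains321 : lookup π r < lookup π q → lookup π q < lookup π p → Contains p321 π
  contains321 x<y y<z = contains₃ x<y y<z π (digit₃ ∷ digit₂ ∷ digit₁ ∷ []) p<q q<r refl refl refl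

module _ (π : List ℕ) (c : ℕ)
         (first  : ∀ i j → i Fin.< j → toℕ j < c → lookup π i < lookup π j)
         (second : ∀ i j → i Fin.< j → c ≤ toℕ i → lookup π i < lookup π j)
         (across : ∀ i j → toℕ i < c → c ≤ toℕ j → lookup π j < lookup π i) where

  private
    inversion⇒straddles : ∀ i j → i Fin.< j → lookup π j < lookup π i → toℕ i < c × c ≤ toℕ j
    inversion⇒straddles i j i<j πj<πi with toℕ j <? c | toℕ i <? c
    ... | yes j<c | _       = contradiction (first i j i<j j<c) (<-asym πj<πi)
    ... | no  j≮c | yes i<c = i<c , ≮⇒≥ j≮c
    ... | no  j≮c | no  i≮c = contradiction (second i j i<j (≮⇒≥ i≮c)) (<-asym πj<πi)

  twoRuns-avoid : Avoids forbidden π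
  twoRuns-avoid = no132 ∷ no213 ∷ no321 ∷ []
    where
    no132 : ¬ Contains p132 π
    no132 (f , increasing , iso)
      with inversion⇒straddles (f (# 1)) (f (# 2)) (increasing (# 1) (# 2) (s<s z<s))
                               (Equivalence.from (iso (# 2) (# 1)) (s<s (s<s z<s)))
    ... | q<c , c≤r = <-asym (Equivalence.from (iso (# 0) (# 2)) (s<s z<s))
                             (across (f (# 0)) (f (# 2)) (<-trans (increasing (# 0) (# 1) z<s) q<c) c≤r)

    no213 : ¬ Contains p213 π
    no213 (f , increasing , iso)
      with inversion⇒straddles (f (# 0)) (f (# 1)) (increasing (# 0) (# 1) z<s)
                               (Equivalence.from (iso (# 1) (# 0)) (s<s z<s))
    ... | p<c , c≤q = <-asym (Equivalence.from (iso (# 0) (# 2)) (s<s (s<s z<s)))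
                             (across (f (# 0)) (f (# 2)) p<c (≤-trans c≤q (<⇒≤ (increasing (# 1) (# 2) (s<s z<s)))))

    no321 : ¬ Contains p321 π
    no321 (f , increasing , iso)
      with inversion⇒straddles (f (# 0)) (f (# 1)) (increasing (# 0) (# 1) z<s)
                               (Equivalence.from (iso (# 1) (# 0)) (s<s (s<s z<s)))
         | inversion⇒straddles (f (# 1)) (f (# 2)) (increasing (# 1) (# 2) (s<s z<s))
                               (Equivalence.from (iso (# 2) (# 1)) (s<s z<s))
    ... | _ , c≤q | q<c , _ = <⇒≱ q<c c≤q

∣m+n∣n⇒∣m : ∀ {d m n} → d ∣ m + n → d ∣ n → d ∣ m
∣m+n∣n⇒∣m {d} {m} {n} d∣m+n = ∣m+n∣m⇒∣n (subst (d ∣_) (+-comm m n) d∣m+n)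

multiple-<⇒+≤ : ∀ {v q n} → v ∣ q → v ∣ n → q < n → q + v ≤ n
multiple-<⇒+≤ {v} (divides a refl) (divides b refl) av<bv =
  subst (_≤ b * v) (+-comm v (a * v)) (*-monoˡ-≤ v (*-cancelʳ-< v a b av<bv))

-- The cyclic successor on 1, …, n

module Cyclic (n : ℕ) where

  csuc : ℕ → ℕ
  csuc x with x <? n
  ... | yes _ = suc x
  ... | no  _ = 1

  csuc-< : ∀ {x} → x < n → csuc x ≡ suc x
  csuc-< {x} x<n with x <? n
  ... | yes _   = refl
  ... | no  x≮n = contradiction x<n x≮n

  csuc-≮ : ∀ {x} → x ≮ n → csuc x ≡ 1
  csuc-≮ {x} x≮n with x <? n
  ... | yes x<n = contradiction x<n x≮n
  ... | no  _   = refl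

  csucⁿ : ℕ → ℕ → ℕ
  csucⁿ k x = ℕ.iterate csuc x k

  orbit : ℕ → ℕ → List ℕ
  orbit = List.iterate csuc

  csucⁿ-+ : ∀ k x → x + k ≤ n → csucⁿ k x ≡ x + k
  csucⁿ-+ zero    x _     = sym (+-identityʳ x)
  csucⁿ-+ (suc k) x x+k≤n = begin
    csucⁿ k (csuc x) ≡⟨ cong (csucⁿ k) (csuc-< (<-≤-trans (m<m+n x (s≤s z≤n)) x+k≤n)) ⟩
    csucⁿ k (suc x)  ≡⟨ csucⁿ-+ k (suc x) (≤-trans (≤-reflexive (sym (+-suc x k))) x+k≤n) ⟩
    suc x + k        ≡⟨ sym (+-suc x k) ⟩
    x + suc k        ∎
    where open ≡-Reasoning

  orbit≡range : ∀ k x → x + k ≤ suc n → orbit x k ≡ range x k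
  orbit≡range zero          x _     = refl
  orbit≡range (suc zero)    x _     = refl
  orbit≡range (suc (suc k)) x x+k≤ = cong (x ∷_) (begin
    orbit (csuc x) (suc k) ≡⟨ cong (λ y → orbit y (suc k)) (csuc-< x<n) ⟩
    orbit (suc x) (suc k)  ≡⟨ orbit≡range (suc k) (suc x) (subst (_≤ suc n) (+-suc x (suc k)) x+k≤) ⟩
    range (suc x) (suc k)  ∎)
    where
    open ≡-Reasoning
    x<n : x < n
    x<n = ≤-pred (≤-trans (≤-reflexive (+-comm 2 x)) (≤-trans (+-monoʳ-≤ x (s≤s (s≤s z≤n))) x+k≤))

  module _ {π : List ℕ} (bounds : ∀ {w} → w ∈ π ⇔ (1 ≤ w × w ≤ n)) (unique : Unique π)
           (no132 : ¬ Contains p132 π) (no213 : ¬ Contains p213 π) (no321 : ¬ Contains p321 π) where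

    private
      π[_] : Fin (length π) → ℕ
      π[_] = lookup π

      located : ∀ {w} → 1 ≤ w → w ≤ n → Σ (Fin (length π)) λ P → π[ P ] ≡ w
      located 1≤w w≤n = let w∈π = Equivalence.from bounds (1≤w , w≤n) in index w∈π , sym (lookup-index w∈π)

      bounded : ∀ i → 1 ≤ π[ i ] × π[ i ] ≤ n
      bounded i = Equivalence.to bounds (∈-lookup i)

      outside : ∀ {i j} P → toℕ j ≡ suc (toℕ i) → π[ P ] ≢ π[ i ] → π[ P ] ≢ π[ j ] →
                P Fin.< i ⊎ j Fin.< P
      outside {i} {j} P j≡1+i P≢i P≢j with <-cmp (toℕ P) (toℕ i)
      ... | tri< P<i _ _ = inj₁ P<i
      ... | tri≈ _ P≡i _ = contradiction (cong π[_] (Fin.toℕ-injective P≡i)) P≢i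
      ... | tri> _ _ i<P with m≤n⇒m<n∨m≡n (subst (_≤ toℕ P) (sym j≡1+i) i<P)
      ...   | inj₁ j<P = inj₂ j<P
      ...   | inj₂ j≡P = contradiction (cong π[_] (Fin.toℕ-injective (sym j≡P))) P≢j

      module _ {i j : Fin (length π)} (adj : toℕ j ≡ suc (toℕ i)) where

        i<j : i Fin.< j
        i<j = ≤-reflexive (sym adj)

        no-value-between : ∀ P → π[ i ] < π[ P ] → π[ P ] < π[ j ] → ⊥
        no-value-between P a<w w<b with outside P adj (>⇒≢ a<w) (<⇒≢ w<b)
        ... | inj₁ P<i = no213 (contains213 π P<i i<j a<w w<b)
        ... | inj₂ j<P = no132 (contains132 π i<j j<P a<w w<b)

        no-value-below : ∀ P → π[ P ] < π[ j ] → π[ j ] < π[ i ] → ⊥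
        no-value-below P w<b b<a with outside P adj (<⇒≢ (<-trans w<b b<a)) (<⇒≢ w<b)
        ... | inj₁ P<i = no132 (contains132 π P<i i<j w<b b<a)
        ... | inj₂ j<P = no321 (contains321 π i<j j<P w<b b<a)

        no-value-above : ∀ P → π[ j ] < π[ i ] → π[ i ] < π[ P ] → ⊥
        no-value-above P b<a a<w with outside P adj (>⇒≢ a<w) (>⇒≢ (<-trans b<a a<w))
        ... | inj₁ P<i = no321 (contains321 π P<i i<j b<a a<w)
        ... | inj₂ j<P = no213 (contains213 π i<j j<P b<a a<w)

        ascent : π[ i ] < π[ j ] → π[ j ] ≡ suc π[ i ]
        ascent a<b with m≤n⇒m<n∨m≡n a<b
        ... | inj₂ 1+a≡b = sym 1+a≡b
        ... | inj₁ 1+a<b with located (s≤s z≤n) (<⇒≤ (<-≤-trans 1+a<b (proj₂ (bounded j))))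
        ...   | P , P≡1+a =
          ⊥-elim (no-value-between P (≤-reflexive (sym P≡1+a)) (subst (_< π[ j ]) (sym P≡1+a) 1+a<b))

        descent-to-one : π[ j ] < π[ i ] → π[ j ] ≡ 1
        descent-to-one b<a with m≤n⇒m<n∨m≡n (proj₁ (bounded j))
        ... | inj₂ 1≡b = sym 1≡b
        ... | inj₁ 1<b with located ≤-refl (≤-trans (proj₁ (bounded j)) (proj₂ (bounded j)))
        ...   | P , P≡1 = ⊥-elim (no-value-below P (subst (_< π[ j ]) (sym P≡1) 1<b) b<a)

        descent-from-top : π[ j ] < π[ i ] → π[ i ] ≮ n
        descent-from-top b<a a<n with located (≤-trans (proj₁ (bounded i)) (<⇒≤ a<n)) ≤-refl
        ... | P , P≡n = no-value-above P b<a (subst (π[ i ] <_) (sym P≡n) a<n)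

    csuc-adjacent : ∀ i j → toℕ j ≡ suc (toℕ i) → lookup π j ≡ csuc (lookup π i)
    csuc-adjacent i j adj with <-cmp π[ i ] π[ j ]
    ... | tri< a<b _ _ = trans (ascent adj a<b) (sym (csuc-< (<-≤-trans a<b (proj₂ (bounded j)))))
    ... | tri≈ _ a≡b _ =
      contradiction (trans (sym adj) (cong toℕ (sym (Unique-lookup-injective unique a≡b)))) 1+n≢n
    ... | tri> _ _ b<a = trans (descent-to-one adj b<a) (sym (csuc-≮ (descent-from-top adj b<a)))

  avoiding⇒orbit : ∀ {π} → (∀ {w} → w ∈ π ⇔ (1 ≤ w × w ≤ n)) → Unique π →
                   ¬ Contains p132 π → ¬ Contains p213 π → ¬ Contains p321 π →
                   1 ≤ n → ∃ λ q → q < n × π ≡ orbit (suc q) (length π)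
  avoiding⇒orbit {[]}     bounds _      _     _     _     1≤n =
    contradiction (Equivalence.from bounds (≤-refl , 1≤n)) λ ()
  avoiding⇒orbit {x ∷ xs} bounds unique no132 no213 no321 _   with Equivalence.to bounds (here refl)
  ... | s≤s z≤n , x≤n =
    _ , x≤n , Linked⇒iterate xs (adjacent⇒Linked (x ∷ xs) (csuc-adjacent bounds unique no132 no213 no321))

  module Rotation {q r : ℕ} (q+1+r≡n : suc (q + r) ≡ n) where

    c : ℕ
    c = suc r

    q+c≡n : q + c ≡ n
    q+c≡n = trans (+-suc q r) q+1+r≡n

    rotation : List ℕ
    rotation = orbit (suc q) n

    wraps : csucⁿ c (suc q) ≡ 1
    wraps = begin
      csucⁿ (suc r) (suc q)      ≡⟨ iterate-suc csuc (suc q) r ⟩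
      csuc (csucⁿ r (suc q))     ≡⟨ cong csuc (trans (csucⁿ-+ r (suc q) (≤-reflexive q+1+r≡n)) q+1+r≡n) ⟩
      csuc n                     ≡⟨ csuc-≮ (<-irrefl refl) ⟩
      1                          ∎
      where open ≡-Reasoning

    value-first : ∀ k → k < c → csucⁿ k (suc q) ≡ suc (q + k)
    value-first k k<c = csucⁿ-+ k (suc q) (subst (suc (q + k) ≤_) q+1+r≡n (s≤s (+-monoʳ-≤ q (≤-pred k<c))))

    value-second : ∀ k → c ≤ k → k < n → csucⁿ k (suc q) ≡ suc (k ∸ c)
    value-second k c≤k k<n = begin
      csucⁿ k (suc q)                  ≡⟨ cong (λ l → csucⁿ l (suc q)) (sym (m+[n∸m]≡n c≤k)) ⟩
      csucⁿ (c + (k ∸ c)) (suc q)      ≡⟨ iterate-+ csuc (suc q) c (k ∸ c) ⟩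
      csucⁿ (k ∸ c) (csucⁿ c (suc q))  ≡⟨ cong (csucⁿ (k ∸ c)) wraps ⟩
      csucⁿ (k ∸ c) 1                  ≡⟨ csucⁿ-+ (k ∸ c) 1 (≤-<-trans (m∸n≤m k c) k<n) ⟩
      suc (k ∸ c)                      ∎
      where open ≡-Reasoning

    rotation-avoids : Avoids forbidden rotation
    rotation-avoids = twoRuns-avoid rotation c first second across
      where
      position<n : ∀ (i : Fin (length rotation)) → toℕ i < n
      position<n i = subst (toℕ i <_) (length-iterate csuc (suc q) n) (Fin.toℕ<n i)

      value : ∀ i → lookup rotation i ≡ csucⁿ (toℕ i) (suc q)
      value = lookup-iterate csuc (suc q) n

      first : ∀ i j → i Fin.< j → toℕ j < c → lookup rotation i < lookup rotation j
      first i j i<j j<c rewrite value i | value j | value-first (toℕ i) (<-trans i<j j<c) | value-first (toℕ j) j<c =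
        s≤s (+-monoʳ-< q i<j)

      second : ∀ i j → i Fin.< j → c ≤ toℕ i → lookup rotation i < lookup rotation j
      second i j i<j c≤i rewrite value i | value j | value-second (toℕ i) c≤i (position<n i)
                               | value-second (toℕ j) (≤-trans c≤i (<⇒≤ i<j)) (position<n j) =
        s≤s (∸-monoˡ-< i<j c≤i)

      across : ∀ i j → toℕ i < c → c ≤ toℕ j → lookup rotation j < lookup rotation i
      across i j i<c c≤j rewrite value i | value j | value-first (toℕ i) i<c | value-second (toℕ j) c≤j (position<n j) =
        s≤s (≤-trans (subst (toℕ j ∸ c <_) (m+n∸n≡m q c)
                            (∸-monoˡ-< (subst (toℕ j <_) (sym q+c≡n) (position<n j)) c≤j))
                     (m≤m+n q (toℕ i)))

    rotation-↭ : rotation ↭ oneTo n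
    rotation-↭ = begin
      orbit (suc q) n                               ≡⟨ cong (orbit (suc q)) (trans (sym q+c≡n) (+-comm q c)) ⟩
      orbit (suc q) (c + q)                         ≡⟨ iterate-++ csuc (suc q) c q ⟩
      orbit (suc q) c ++ orbit (csucⁿ c (suc q)) q  ≡⟨ cong (λ x → orbit (suc q) c ++ orbit x q) wraps ⟩
      orbit (suc q) c ++ orbit 1 q
        ≡⟨ cong₂ _++_ (orbit≡range c (suc q) (s≤s (≤-reflexive q+c≡n)))
                      (orbit≡range q 1 (s≤s (≤-trans (m≤m+n q c) (≤-reflexive q+c≡n)))) ⟩
      range (suc q) c ++ range 1 q                  ↭⟨ ++-comm (range (suc q) c) (range 1 q) ⟩
      range 1 q ++ range (suc q) c                  ≡⟨ range-++ 1 q c ⟨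
      range 1 (q + c)                               ≡⟨ cong (range 1) q+c≡n ⟩
      range 1 n                                     ≡⟨ oneTo≡range n ⟨
      oneTo n                                       ∎
      where open PermutationReasoning

  1<csuc⇒<n : ∀ {x} → 1 < csuc x → x < n
  1<csuc⇒<n {x} 1<csuc with x <? n
  ... | yes x<n = x<n
  ... | no  _   = contradiction 1<csuc (<-irrefl refl)

  no-wrap : ∀ k {x} → x ≤ n → All (1 <_) (orbit (csuc x) k) → x + k ≤ n
  no-wrap zero    {x} x≤n _ = subst (_≤ n) (sym (+-identityʳ x)) x≤n
  no-wrap (suc k) {x} x≤n (1<csuc ∷ rest) =
    subst (_≤ n) (sym (+-suc x k)) (no-wrap k x<n (subst (λ y → All (1 <_) (orbit (csuc y) k)) (csuc-< x<n) rest))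
    where x<n = 1<csuc⇒<n 1<csuc

  diamond : (m : ℕ) → ℕ → Diamond (2 + m)
  diamond m x = x , Vec.iterate csuc (csuc x) m , csucⁿ (suc m) x

  diamonds : (m : ℕ) → ℕ → (k : ℕ) → Labelling (2 + m) k
  diamonds m x zero    = Vec.[]
  diamonds m x (suc k) = diamond m x Vec.∷ diamonds m (csucⁿ (2 + m) x) k

  readDiamond-diamond : ∀ m x → readDiamond (2 + m) (diamond m x) ≡ orbit x (2 + m)
  readDiamond-diamond m x = cong (x ∷_) (begin
    Vec.toList (Vec.iterate csuc (csuc x) m) ∷ʳ csucⁿ m (csuc x)
      ≡⟨ cong (_∷ʳ csucⁿ m (csuc x)) (toList-iterate csuc (csuc x) m) ⟩
    orbit (csuc x) m ∷ʳ csucⁿ m (csuc x)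
      ≡⟨ iterate-∷ʳ csuc (csuc x) m ⟨
    orbit (csuc x) (suc m)
      ∎)
    where open ≡-Reasoning

  πD-diamonds : ∀ m x k → πD (2 + m) k (diamonds m x k) ≡ orbit x (k * (2 + m))
  πD-diamonds m x zero    = refl
  πD-diamonds m x (suc k) = begin
    readDiamond (2 + m) (diamond m x) ++ πD (2 + m) k (diamonds m (csucⁿ (2 + m) x) k)
      ≡⟨ cong₂ _++_ (readDiamond-diamond m x) (πD-diamonds m (csucⁿ (2 + m) x) k) ⟩
    orbit x (2 + m) ++ orbit (csucⁿ (2 + m) x) (k * (2 + m))
      ≡⟨ iterate-++ csuc x (2 + m) (k * (2 + m)) ⟨
    orbit x (suc k * (2 + m))
      ∎
    where open ≡-Reasoning

  diamond-ordered⇔ : ∀ m {q} → q < n → DiamondOrdered (3 + m) (diamond (suc m) (suc q)) ⇔ q + (3 + m) ≤ n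
  diamond-ordered⇔ m {q} q<n = mk⇔ ordered⇒fits fits⇒ordered
    where
    x      = suc q
    middles = Vec.toList (Vec.iterate csuc (csuc x) (suc m))
    top     = csucⁿ (2 + m) x

    x+2+m≡q+v : x + (2 + m) ≡ q + (3 + m)
    x+2+m≡q+v = sym (+-suc q (2 + m))

    middles≡ : middles ≡ orbit (csuc x) (suc m)
    middles≡ = toList-iterate csuc (csuc x) (suc m)

    ordered⇒fits : All (λ z → x < z × z < top) middles → q + (3 + m) ≤ n
    ordered⇒fits ordered@((x<z , z<top) ∷ _) =
      subst (_≤ n) x+2+m≡q+v (no-wrap (2 + m) q<n (subst (All (1 <_)) orbit≡ (All⁺.++⁺ above-1 (1<top ∷ []))))
      where
      above-1 : All (1 <_) middles
      above-1 = All.map (λ (x<z , _) → ≤-<-trans (s≤s z≤n) x<z) ordered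
      1<top : 1 < top
      1<top = ≤-<-trans (s≤s z≤n) (<-trans x<z z<top)
      orbit≡ : middles ∷ʳ top ≡ orbit (csuc x) (2 + m)
      orbit≡ = trans (cong (_∷ʳ top) middles≡) (sym (iterate-∷ʳ csuc (csuc x) (suc m)))

    fits⇒ordered : q + (3 + m) ≤ n → All (λ z → x < z × z < top) middles
    fits⇒ordered fits = subst (All (λ z → x < z × z < top)) (sym middles≡range)
                          (All.map (λ (1+x≤z , z<) → 1+x≤z , subst (_ <_) (sym top≡) (<-≤-trans z< (≤-reflexive 1+x+1+m≡x+2+m)))
                                   (All-range (suc x) (suc m)))
      where
      fits′ : x + (2 + m) ≤ n
      fits′ = subst (_≤ n) (sym x+2+m≡q+v) fits
      x<n : x < n
      x<n = <-≤-trans (m<m+n x (s≤s z≤n)) fits′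
      1+x+1+m≡x+2+m : suc x + suc m ≡ x + (2 + m)
      1+x+1+m≡x+2+m = sym (+-suc x (suc m))
      top≡ : top ≡ x + (2 + m)
      top≡ = csucⁿ-+ (2 + m) x fits′
      middles≡range : middles ≡ range (suc x) (suc m)
      middles≡range = begin
        middles                 ≡⟨ middles≡ ⟩
        orbit (csuc x) (suc m)  ≡⟨ cong (λ y → orbit y (suc m)) (csuc-< x<n) ⟩
        orbit (suc x) (suc m)   ≡⟨ orbit≡range (suc m) (suc x) (s≤s (≤-trans (+-monoʳ-≤ x (n≤1+n _)) fits′)) ⟩
        range (suc x) (suc m)   ∎
        where open ≡-Reasoning

  module _ (m : ℕ) (v∣n : 3 + m ∣ n) where

    private
      v = 3 + m

      OrderedFrom : ℕ → ℕ → Set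
      OrderedFrom x k = VAll.All (DiamondOrdered v) (diamonds (suc m) x k)

      next-start : ∀ {q} → q + v ≤ n → csucⁿ v (suc q) ≡ csuc (q + v)
      next-start {q} fits = begin
        csucⁿ v (suc q)               ≡⟨ iterate-suc csuc (suc q) (2 + m) ⟩
        csuc (csucⁿ (2 + m) (suc q))
          ≡⟨ cong csuc (csucⁿ-+ (2 + m) (suc q) (subst (_≤ n) (+-suc q (2 + m)) fits)) ⟩
        csuc (suc q + (2 + m))        ≡⟨ cong csuc (sym (+-suc q (2 + m))) ⟩
        csuc (q + v)                  ∎
        where open ≡-Reasoning

    ∣⇒diamonds-ordered : ∀ k q → v ∣ q → q < n → OrderedFrom (suc q) k
    ∣⇒diamonds-ordered zero    q _   _   = VAll.[]
    ∣⇒diamonds-ordered (suc k) q v∣q q<n =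
      Equivalence.from (diamond-ordered⇔ m q<n) fits VAll.∷ subst (λ x → OrderedFrom x k) (sym (next-start fits)) rest
      where
      fits = multiple-<⇒+≤ v∣q v∣n q<n
      rest : OrderedFrom (csuc (q + v)) k
      rest with m≤n⇒m<n∨m≡n fits
      ... | inj₁ q+v<n = subst (λ x → OrderedFrom x k) (sym (csuc-< q+v<n))
                               (∣⇒diamonds-ordered k (q + v) (∣m∣n⇒∣m+n v∣q ∣-refl) q+v<n)
      ... | inj₂ q+v≡n = subst (λ x → OrderedFrom x k) (sym (csuc-≮ (λ q+v<n → <-irrefl q+v≡n q+v<n)))
                               (∣⇒diamonds-ordered k 0 (v ∣0) (≤-<-trans z≤n q<n))

    -- n ≤ q + k * v: the blocks reach the value n, so the step n → 1 must fall between two of them.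
    diamonds-ordered⇒∣ : ∀ k q → q < n → n ≤ q + k * v → OrderedFrom (suc q) k → v ∣ q
    diamonds-ordered⇒∣ zero    q q<n n≤q+0 _ =
      contradiction (<-≤-trans q<n n≤q+0) (subst (q ≮_) (sym (+-identityʳ q)) (<-irrefl refl))
    diamonds-ordered⇒∣ (suc k) q q<n n≤ (first VAll.∷ rest)
      with fits ← Equivalence.to (diamond-ordered⇔ m q<n) first
      with m≤n⇒m<n∨m≡n fits
    ... | inj₁ q+v<n = ∣m+n∣n⇒∣m (diamonds-ordered⇒∣ k (q + v) q+v<n (subst (n ≤_) (sym (+-assoc q v (k * v))) n≤)
                                   (subst (λ x → OrderedFrom x k) (trans (next-start fits) (csuc-< q+v<n)) rest)) ∣-refl
    ... | inj₂ q+v≡n = ∣m+n∣n⇒∣m (subst (v ∣_) (sym q+v≡n) v∣n) ∣-refl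

module Classification (m d′ : ℕ) where

  private
    v d n : ℕ
    v = 3 + m
    d = suc d′
    n = v * d

  open Cyclic n

  labelling : ℕ → Labelling v d
  labelling t = diamonds (suc m) (suc (t * v)) d

  private
    v∣n : v ∣ n
    v∣n = m∣m*n d

    πD-diamonds′ : ∀ x → πD v d (diamonds (suc m) x d) ≡ orbit x n
    πD-diamonds′ x = trans (πD-diamonds (suc m) x d) (cong (orbit x) (*-comm d v))

  labelling-injective : ∀ {t t′} → labelling t ≡ labelling t′ → t ≡ t′
  labelling-injective eq = *-cancelʳ-≡ _ _ v (suc-injective (cong (proj₁ ∘ Vec.head) eq))

  diamonds-InDP : ∀ {q} → q < n → v ∣ q → InDP v d forbidden (diamonds (suc m) (suc q) d)
  diamonds-InDP {q} q<n v∣q with r , q+1+r≡n ← m≤n⇒∃[o]m+o≡n q<n =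
    (subst (_↭ oneTo n) (sym πD≡) rotation-↭ , ∣⇒diamonds-ordered m v∣n d q v∣q q<n) ,
    subst (Avoids forbidden) (sym πD≡) rotation-avoids
    where
    open Rotation {q} {r} q+1+r≡n
    πD≡ = πD-diamonds′ (suc q)

  labelling-InDP : ∀ {t} → t < d → InDP v d forbidden (labelling t)
  labelling-InDP {t} t<d = diamonds-InDP (subst (t * v <_) (*-comm d v) (*-monoˡ-< v t<d)) (divides t refl)

  private
    πD≡orbit⇒≡diamonds : ∀ {D q} → πD v d D ≡ orbit (suc q) n → D ≡ diamonds (suc m) (suc q) d
    πD≡orbit⇒≡diamonds {D} eq = πD-injective v d D _ (trans eq (sym (πD-diamonds′ _)))

  InDP⇒labelling : ∀ D → InDP v d forbidden D → ∃ λ t → t < d × D ≡ labelling t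
  InDP⇒labelling D ((πD↭ , ordered) , no132 ∷ no213 ∷ no321 ∷ [])
    with q , q<n , π≡orbit ← avoiding⇒orbit (↭oneTo⇒∈⇔ πD↭) (↭oneTo⇒Unique πD↭)
                                            no132 no213 no321 (s≤s z≤n)
    with refl ← πD≡orbit⇒≡diamonds {D} (trans π≡orbit (cong (orbit (suc q)) (↭oneTo⇒length πD↭)))
    with divides t refl ← diamonds-ordered⇒∣ m v∣n d q q<n
                            (subst (_≤ q + d * v) (*-comm d v) (m≤n+m (d * v) q)) ordered
    = t , *-cancelʳ-< v t d (subst (t * v <_) (*-comm v d) q<n) , refl

  labellings : List (Labelling v d)
  labellings = map labelling (upTo d)

  length-labellings : length labellings ≡ d
  length-labellings = trans (length-map labelling (upTo d)) (length-upTo d)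

  labellings-Unique : Unique labellings
  labellings-Unique = Unique.map⁺ labelling-injective (Unique.upTo⁺ d)

  ∈-labellings⇔InDP : ∀ D → D ∈ labellings ⇔ InDP v d forbidden D
  ∈-labellings⇔InDP D = mk⇔ sound complete
    where
    sound : D ∈ labellings → InDP v d forbidden D
    sound D∈ = let t , t∈ , D≡ = ∈-map⁻ labelling D∈ in
      subst (InDP v d forbidden) (sym D≡) (labelling-InDP (∈-upTo⁻ t∈))
    complete : InDP v d forbidden D → D ∈ labellings
    complete D∈D = let t , t<d , D≡ = InDP⇒labelling D D∈D in
      subst (_∈ labellings) (sym D≡) (∈-map⁺ labelling (∈-upTo⁺ t<d))

corollary4p2 : (v d : ℕ) → 4 ≤ v → 1 ≤ d →
    Σ (List (Labelling v d)) λ L →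
      (length L ≡ d) × Unique L ×
      ((D : Labelling v d) → (D ∈ L) ⇔ InDP v d (p132 ∷ p213 ∷ p321 ∷ []) D)
corollary4p2 (suc (suc (suc m))) (suc d′) (s≤s (s≤s (s≤s _))) _ =
  labellings , length-labellings , labellings-Unique , ∈-labellings⇔InDP
  where open Classification m d′
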